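{- Consider the state described in the context, with final bucket sizes $N^f=(n^f_i)_{i=1}^k$. Let $d_i=n^f_i-n/k$ and $D_i=\sum_{j=1}^i d_j$. Then TwoSweep executes a total of $M(N^f)=\sum_{i=1}^k|D_i|$ swaps and takes time $O(k+M(N^f))$.
   Context: An array $X[1..n]$ is split into $k$ contiguous buckets $B_1,\dots,B_k$ in this order, each of size $n/k$. Each bucket consists of a contiguous region of "placed" items followed by a contiguous region of "staged" items; staged items may be freely reordered and exchanged between buckets. Bucket $B_i$ has $n_i$ placed items; final sizes $n^f_i=n_i+n'_i$ with $n'_i\ge0$ and $\sum_i n^f_i=n$ are given. A staged item can be exchanged between adjacent buckets $B_i$ and $B_{i+1}$ by a single swap plus $O(1)$ pointer updates (shifting their common boundary). TwoSweep: in a first sweep over the buckets in increasing index order, maintaining the number of items needed to the left of the current bucket, whenever buckets $B_1,\dots,B_i$ together hold more items than their final sizes require, the excess staged items are moved across the boundary into $B_{i+1}$; in a second sweep from $B_k$ down to $B_1$, remaining excess staged items are moved towards smaller bucket indices. Afterwards every bucket $B_i$ has exactly $n^f_i$ items. -}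

module Defs where

open import Data.Nat using (ℕ; zero; suc; _+_; _*_; _∸_; _≤_)
open import Data.Integer as ℤ using (ℤ; +_; ∣_∣)
open import Data.Fin using (Fin; toℕ)
open import Data.Product using (_×_; _,_; proj₁)
open import Data.Maybe using (Maybe; just; nothing)
open import Data.Maybe.Base using (_>>=_)
open import Data.List as List using (List; []; _∷_; reverse; take; map)

-- A bucket in the count model: (number of placed items , number of staged items).
-- Within the array, a bucket is its placed region followed by its staged region.
Bucket : Set
Bucket = ℕ × ℕ

size : Bucket → ℕ
size (p , t) = p + t

-- moveR e b b' : move e staged items, one at a time, from bucket b to the
-- adjacent bucket b' (each move = one swap + O(1) pointer updates, shifting
-- the common boundary).
moveR : ℕ → Bucket → Bucket → Maybe (Bucket × Bucket)
moveR zero    b         b'         = just (b , b')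
moveR (suc e) (p , zero)  b'       = nothing
moveR (suc e) (p , suc t) (p' , t') = moveR e (p , t) (p' , suc t')

-- One sweep over a list of buckets (each paired with its final size),
-- in list order.  "need" = number of items still needed by the buckets
-- to the left of the current one.
-- Result: (new buckets , number of swaps , time) where time counts one
-- unit per bucket visited and one unit per swap (swap + O(1) updates).
sweepFrom : ℕ → Bucket × ℕ → List (Bucket × ℕ) →
            Maybe (List (Bucket × ℕ) × ℕ × ℕ)
sweepFrom need x [] = just (x ∷ [] , 0 , 1)
sweepFrom need (b , f) ((b' , f') ∷ rest) =
  moveR e b b' >>= λ where
    (b₁ , b₁') → sweepFrom need' (b₁' , f') rest >>= λ where
      (r , sw , t) → just ((b₁ , f) ∷ r , e + sw , suc (e + t))
  where
    e     = size b ∸ (need + f)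
    need' = (need + f) ∸ size b

sweep : List (Bucket × ℕ) → Maybe (List (Bucket × ℕ) × ℕ × ℕ)
sweep []       = just ([] , 0 , 0)
sweep (x ∷ xs) = sweepFrom 0 x xs

-- Initial state: k buckets of size s = n/k; bucket i has p i placed items
-- and s ∸ p i staged items; f i is its final size.
initial : (k s : ℕ) → (p f : Fin k → ℕ) → List (Bucket × ℕ)
initial k s p f = List.tabulate (λ i → ((p i , s ∸ p i) , f i))

-- TwoSweep: first sweep B_1 → B_k (moving excess right), second sweep
-- B_k → B_1 (moving excess left; realised as the mirror-image sweep on the
-- reversed bucket list).
twoSweep : (k s : ℕ) → (p f : Fin k → ℕ) → Maybe (List (Bucket × ℕ) × ℕ × ℕ)
twoSweep k s p f =
  sweep (initial k s p f) >>= λ where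
    (r₁ , sw₁ , t₁) → sweep (reverse r₁) >>= λ where
      (r₂ , sw₂ , t₂) → just (reverse r₂ , sw₁ + sw₂ , t₁ + t₂)

sumℕ : List ℕ → ℕ
sumℕ = List.foldr _+_ 0

sumℤ : List ℤ → ℤ
sumℤ = List.foldr ℤ._+_ (+ 0)

d : (s : ℕ) → {k : ℕ} → (f : Fin k → ℕ) → Fin k → ℤ
d s f i = + f i ℤ.- + s

D : (s : ℕ) → {k : ℕ} → (f : Fin k → ℕ) → Fin k → ℤ
D s f i = sumℤ (take (suc (toℕ i)) (List.tabulate (d s f)))

M : (s : ℕ) → {k : ℕ} → (f : Fin k → ℕ) → ℕ
M s f = sumℕ (List.tabulate (λ i → ∣ D s f i ∣))

-- The first sweep moves the surplus of the prefix B_1..B_i, max(0, -D_i) items, across the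
-- boundary between B_i and B_(i+1); the second sweep moves the remaining deficit of that prefix,
-- max(0, D_i) items, back across it, so that boundary sees |D_i| swaps.  A bucket never has to
-- give away more than its staged items, because its placed items fit in its final size.  Both sweeps
-- are handled by one induction over the buckets, the right-to-left second sweep being described
-- as a continuation of what it does to the right of the current bucket.
module Submission where

open import Defs
open import Data.Nat using (ℕ; zero; suc; _+_; _*_; _∸_; _≤_; z≤n; s≤s)
open import Data.Nat.Properties
open import Data.Nat.Tactic.RingSolver using (solve-∀)
open import Data.Integer as ℤ using (ℤ; +_; ∣_∣; _⊖_)
import Data.Integer.Properties as ℤₚ
import Data.Integer.Tactic.RingSolver as ℤ-Solver
open import Data.Fin as Fin using (Fin; toℕ)
open import Data.Product using (Σ; ∃; _×_; _,_; proj₁; proj₂)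
open import Data.Maybe using (Maybe; just; nothing)
open import Data.Maybe.Base using (_>>=_)
open import Data.List as List using (List; []; _∷_; _++_; _ʳ++_; map; reverse; length; take)
open import Data.List.Properties
  using (++-assoc; map-++; map-tabulate; tabulate-cong; length-tabulate;
         reverse-map; reverse-++; reverse-involutive; unfold-reverse)
open import Data.List.Relation.Unary.All using (All; []; _∷_)
open import Data.List.Relation.Unary.All.Properties using (tabulate⁺)
open import Function using (_∘_)
open import Relation.Binary.PropositionalEquality
open ≡-Reasoning

m+[n∸m]≡n+[m∸n] : ∀ m n → m + (n ∸ m) ≡ n + (m ∸ n)
m+[n∸m]≡n+[m∸n] zero    zero    = refl
m+[n∸m]≡n+[m∸n] zero    (suc n) = sym (+-identityʳ (suc n))
m+[n∸m]≡n+[m∸n] (suc m) zero    = +-identityʳ (suc m)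
m+[n∸m]≡n+[m∸n] (suc m) (suc n) = cong suc (m+[n∸m]≡n+[m∸n] m n)

m+x≡n+y⇒x+[m∸n]≡y+[n∸m] : ∀ m n x y → m + x ≡ n + y → x + (m ∸ n) ≡ y + (n ∸ m)
m+x≡n+y⇒x+[m∸n]≡y+[n∸m] m n x y eq = +-cancelˡ-≡ n _ _ (begin
  n + (x + (m ∸ n))  ≡⟨ swap n x (m ∸ n) ⟩
  x + (n + (m ∸ n))  ≡⟨ cong (λ z → x + z) (m+[n∸m]≡n+[m∸n] m n) ⟨
  x + (m + (n ∸ m))  ≡⟨ swap x m (n ∸ m) ⟩
  m + (x + (n ∸ m))  ≡⟨ +-assoc m x (n ∸ m) ⟨
  (m + x) + (n ∸ m)  ≡⟨ cong (_+ (n ∸ m)) eq ⟩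
  (n + y) + (n ∸ m)  ≡⟨ +-assoc n y (n ∸ m) ⟩
  n + (y + (n ∸ m))  ∎)
  where
  swap : ∀ a b c → a + (b + c) ≡ b + (a + c)
  swap = solve-∀

m+u≡n+o∧m≤o⇒n≤u : ∀ m u n o → m + u ≡ n + o → m ≤ o → n ≤ u
m+u≡n+o∧m≤o⇒n≤u m u n o eq m≤o = +-cancelʳ-≤ o n u
  (≤-trans (≤-reflexive (sym eq)) (≤-trans (+-monoˡ-≤ u m≤o) (≤-reflexive (+-comm o u))))

m⊖n≡[m∸n]⊖[n∸m] : ∀ m n → m ⊖ n ≡ (m ∸ n) ⊖ (n ∸ m)
m⊖n≡[m∸n]⊖[n∸m] zero    zero    = refl
m⊖n≡[m∸n]⊖[n∸m] zero    (suc n) = refl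
m⊖n≡[m∸n]⊖[n∸m] (suc m) zero    = refl
m⊖n≡[m∸n]⊖[n∸m] (suc m) (suc n) = trans (ℤₚ.[1+m]⊖[1+n]≡m⊖n m n) (m⊖n≡[m∸n]⊖[n∸m] m n)

∣m⊖n∣≡[m∸n]+[n∸m] : ∀ m n → ∣ m ⊖ n ∣ ≡ (m ∸ n) + (n ∸ m)
∣m⊖n∣≡[m∸n]+[n∸m] zero    zero    = refl
∣m⊖n∣≡[m∸n]+[n∸m] zero    (suc n) = refl
∣m⊖n∣≡[m∸n]+[n∸m] (suc m) zero    = sym (+-identityʳ (suc m))
∣m⊖n∣≡[m∸n]+[n∸m] (suc m) (suc n) =
  trans (cong ∣_∣ (ℤₚ.[1+m]⊖[1+n]≡m⊖n m n)) (∣m⊖n∣≡[m∸n]+[n∸m] m n)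

Run : Set
Run = List (Bucket × ℕ) × ℕ × ℕ

prefixRun : List (Bucket × ℕ) → ℕ → ℕ → Run → Maybe Run
prefixRun F sw t (r , sw′ , t′) = just (F ++ r , sw + sw′ , t + t′)

prefixRun-[] : ∀ m → (m >>= prefixRun [] 0 0) ≡ m
prefixRun-[] nothing  = refl
prefixRun-[] (just _) = refl

prefixRun-++ : ∀ m F sw t G sw′ t′ →
  ((m >>= prefixRun G sw′ t′) >>= prefixRun F sw t) ≡ (m >>= prefixRun (F ++ G) (sw + sw′) (t + t′))
prefixRun-++ nothing                F sw t G sw′ t′ = refl
prefixRun-++ (just (r , sw″ , t″)) F sw t G sw′ t′ =
  cong₂ (λ r′ c → just (r′ , c)) (sym (++-assoc F G r))
        (cong₂ _,_ (sym (+-assoc sw sw′ sw″)) (sym (+-assoc t t′ t″)))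

moveR-staged : ∀ {e t} p p′ t′ → e ≤ t → moveR e (p , t) (p′ , t′) ≡ just ((p , t ∸ e) , (p′ , t′ + e))
moveR-staged {zero}  {t}     p p′ t′ _ =
  cong (λ t″ → just ((p , t) , (p′ , t″))) (sym (+-identityʳ t′))
moveR-staged {suc e} {suc t} p p′ t′ (s≤s e≤t) =
  trans (moveR-staged p p′ (suc t′) e≤t) (cong (λ t″ → just ((p , t ∸ e) , (p′ , t″))) (sym (+-suc t′ e)))

sweepFrom-moves : ∀ need b f b′ f′ rest {b₁ b₁′} →
  moveR (size b ∸ (need + f)) b b′ ≡ just (b₁ , b₁′) →
  sweepFrom need (b , f) ((b′ , f′) ∷ rest) ≡
    (sweepFrom ((need + f) ∸ size b) (b₁′ , f′) rest >>=
       prefixRun ((b₁ , f) ∷ []) (size b ∸ (need + f)) (suc (size b ∸ (need + f))))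
sweepFrom-moves need b f b′ f′ rest eq rewrite eq = refl

sweepFrom-handsBack : ∀ {q u n′ f′} p t f pre → q + u ≡ n′ + f′ → q ≤ f′ →
  sweepFrom 0 ((q , u) , f′) (((p , t) , f) ∷ pre) ≡
    (sweepFrom 0 ((p , t + n′) , f) pre >>= prefixRun (((q , u ∸ n′) , f′) ∷ []) n′ (suc n′))
sweepFrom-handsBack {q} {u} {n′} {f′} p t f pre eq q≤f′ =
  trans (sweepFrom-moves 0 (q , u) f′ (p , t) f pre moves)
        (cong₂ (λ need e → sweepFrom need ((p , t + n′) , f) pre >>=
                             prefixRun (((q , u ∸ n′) , f′) ∷ []) e (suc e))
               nothing-needed excess)
  where
  excess : q + u ∸ f′ ≡ n′
  excess = trans (cong (_∸ f′) eq) (m+n∸n≡m n′ f′)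
  nothing-needed : f′ ∸ (q + u) ≡ 0
  nothing-needed = trans (cong (λ z → f′ ∸ z) eq) (m≤n⇒m∸n≡0 (m≤n+m f′ n′))
  moves : moveR (q + u ∸ f′) (q , u) (p , t) ≡ just ((q , u ∸ n′) , (p , t + n′))
  moves = trans (cong (λ e → moveR e (q , u) (p , t)) excess)
                (moveR-staged q p t (m+u≡n+o∧m≤o⇒n≤u q u n′ f′ eq q≤f′))

deficit : Bucket × ℕ → ℤ
deficit (b , f) = + f ℤ.- + size b

sumAbsPrefixSums : ℤ → List ℤ → ℕ
sumAbsPrefixSums acc []       = 0
sumAbsPrefixSums acc (x ∷ xs) = ∣ acc ℤ.+ x ∣ + sumAbsPrefixSums (acc ℤ.+ x) xs

sumAbsPrefixSums-0∷ : ∀ x xs → sumAbsPrefixSums (+ 0) (x ∷ xs) ≡ ∣ x ∣ + sumAbsPrefixSums x xs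
sumAbsPrefixSums-0∷ x xs = cong (λ y → ∣ y ∣ + sumAbsPrefixSums y xs) (ℤₚ.+-identityˡ x)

∣deficit∣ : ∀ b C → ∣ deficit (b , C) ∣ ≡ (C ∸ size b) + (size b ∸ C)
∣deficit∣ b C = trans (cong ∣_∣ (ℤₚ.m-n≡m⊖n C (size b))) (∣m⊖n∣≡[m∸n]+[n∸m] C (size b))

deficit-carry : ∀ b C p′ t′ f′ →
  deficit (b , C) ℤ.+ deficit ((p′ , t′) , f′) ≡
  deficit ((p′ , t′ + (size b ∸ C)) , (C ∸ size b) + f′)
deficit-carry b C p′ t′ f′ = begin
  (+ C ℤ.- + A) ℤ.+ (+ f′ ℤ.- + (p′ + t′))
    ≡⟨ cong₂ (λ x y → x ℤ.+ (+ f′ ℤ.- y)) difference (ℤₚ.pos-+ p′ t′) ⟩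
  (+ n′ ℤ.- + e) ℤ.+ (+ f′ ℤ.- (+ p′ ℤ.+ + t′))
    ≡⟨ regroup (+ n′) (+ e) (+ f′) (+ p′) (+ t′) ⟩
  (+ n′ ℤ.+ + f′) ℤ.- (+ p′ ℤ.+ (+ t′ ℤ.+ + e))
    ≡⟨ cong₂ ℤ._-_ (ℤₚ.pos-+ n′ f′)
             (trans (ℤₚ.pos-+ p′ (t′ + e)) (cong (λ z → + p′ ℤ.+ z) (ℤₚ.pos-+ t′ e))) ⟨
  + (n′ + f′) ℤ.- + (p′ + (t′ + e))
    ∎
  where
  A e n′ : ℕ
  A  = size b
  e  = A ∸ C
  n′ = C ∸ A
  difference : + C ℤ.- + A ≡ + n′ ℤ.- + e
  difference = trans (ℤₚ.m-n≡m⊖n C A) (trans (m⊖n≡[m∸n]⊖[n∸m] C A) (sym (ℤₚ.m-n≡m⊖n n′ e)))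
  regroup : ∀ u v w x y → (u ℤ.- v) ℤ.+ (w ℤ.- (x ℤ.+ y)) ≡ (u ℤ.+ w) ℤ.- (x ℤ.+ (y ℤ.+ v))
  regroup = ℤ-Solver.solve-∀

Fits : Bucket × ℕ → Set
Fits ((p , _) , f) = p ≤ f

totalSize : List (Bucket × ℕ) → ℕ
totalSize xs = sumℕ (map (size ∘ proj₁) xs)

totalFinal : List (Bucket × ℕ) → ℕ
totalFinal xs = sumℕ (map proj₂ xs)

-- n is the number of items still missing to the left of bucket b.  Once the first sweep has
-- passed, the second sweep fills b up to n + f items (settled) and then hands n of them on.
record BothSweeps (n : ℕ) (b : Bucket) (f : ℕ) (xs : List (Bucket × ℕ)) : Set where
  field
    out₁         : List (Bucket × ℕ)
    swaps₁ time₁ : ℕ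
    sweep₁       : sweepFrom n (b , f) xs ≡ just (out₁ , swaps₁ , time₁)
    settled      : Bucket
    out₂         : List (Bucket × ℕ)
    swaps₂ time₂ : ℕ
    sweep₂       : ∀ pre → sweep (out₁ ʳ++ pre) ≡
                           (sweepFrom 0 (settled , f) pre >>= prefixRun out₂ swaps₂ time₂)
    settled-size : size settled ≡ n + f
    settled-fits : proj₁ settled ≤ f
    out₂-sizes   : map (size ∘ proj₁) out₂ ≡ reverse (map proj₂ xs)
    swaps-total  : swaps₁ + swaps₂ ≡
                   ∣ deficit (b , n + f) ∣ + sumAbsPrefixSums (deficit (b , n + f)) (map deficit xs)
    time₁-exact  : time₁ ≡ suc (length xs) + swaps₁
    time₂-exact  : time₂ ≡ length xs + swaps₂

bothSweeps-[] : ∀ {n p t f} → p ≤ f → p + t ≡ n + f → BothSweeps n (p , t) f []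
bothSweeps-[] {n} {p} {t} {f} p≤f size≡ = record
  { out₁         = ((p , t) , f) ∷ []
  ; swaps₁       = 0
  ; time₁        = 1
  ; sweep₁       = refl
  ; settled      = (p , t)
  ; out₂         = []
  ; swaps₂       = 0
  ; time₂        = 0
  ; sweep₂       = λ _ → sym (prefixRun-[] _)
  ; settled-size = size≡
  ; settled-fits = p≤f
  ; out₂-sizes   = refl
  ; swaps-total  = sym (trans (+-identityʳ _)
                     (trans (cong (λ a → ∣ + (n + f) ℤ.- + a ∣) size≡) (cong ∣_∣ (ℤₚ.+-inverseʳ (+ (n + f))))))
  ; time₁-exact  = refl
  ; time₂-exact  = refl
  }

refilled-size : ∀ p t C → (p + t) ∸ C ≤ t → p + ((t ∸ ((p + t) ∸ C)) + (C ∸ (p + t))) ≡ C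
refilled-size p t C e≤t = +-cancelʳ-≡ e _ _ (begin
  p + ((t ∸ e) + n′) + e  ≡⟨ regroup p (t ∸ e) n′ e ⟩
  p + ((t ∸ e) + e) + n′  ≡⟨ cong (λ z → p + z + n′) (m∸n+n≡m e≤t) ⟩
  p + t + n′              ≡⟨ m+[n∸m]≡n+[m∸n] (p + t) C ⟩
  C + e                   ∎)
  where
  e n′ : ℕ
  e  = (p + t) ∸ C
  n′ = C ∸ (p + t)
  regroup : ∀ a b c d → a + (b + c) + d ≡ a + (b + d) + c
  regroup = solve-∀

bothSweeps-∷ : ∀ {n p t f p′ t′ f′ ys} → p ≤ f →
  BothSweeps ((n + f) ∸ (p + t)) (p′ , t′ + ((p + t) ∸ (n + f))) f′ ys →
  BothSweeps n (p , t) f (((p′ , t′) , f′) ∷ ys)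
bothSweeps-∷ {n} {p} {t} {f} {p′} {t′} {f′} {ys} p≤f R = record
  { out₁         = moved ∷ IH.out₁
  ; swaps₁       = e + IH.swaps₁
  ; time₁        = suc (e + IH.time₁)
  ; sweep₁       = trans (sweepFrom-moves n (p , t) f (p′ , t′) f′ ys (moveR-staged p p′ t′ e≤t))
                         (cong (_>>= prefixRun (moved ∷ []) e (suc e)) IH.sweep₁)
  ; settled      = (p , (t ∸ e) + n′)
  ; out₂         = IH.out₂ ++ (handedBack ∷ [])
  ; swaps₂       = IH.swaps₂ + n′
  ; time₂        = IH.time₂ + suc n′
  ; sweep₂       = λ pre → begin
      sweep (IH.out₁ ʳ++ (moved ∷ pre))
        ≡⟨ IH.sweep₂ (moved ∷ pre) ⟩
      (sweepFrom 0 (IH.settled , f′) (moved ∷ pre) >>= prefixRun IH.out₂ IH.swaps₂ IH.time₂)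
        ≡⟨ cong (_>>= prefixRun IH.out₂ IH.swaps₂ IH.time₂)
                (sweepFrom-handsBack p (t ∸ e) f pre IH.settled-size IH.settled-fits) ⟩
      ((sweepFrom 0 ((p , (t ∸ e) + n′) , f) pre >>= prefixRun (handedBack ∷ []) n′ (suc n′))
         >>= prefixRun IH.out₂ IH.swaps₂ IH.time₂)
        ≡⟨ prefixRun-++ (sweepFrom 0 ((p , (t ∸ e) + n′) , f) pre)
                        IH.out₂ IH.swaps₂ IH.time₂ (handedBack ∷ []) n′ (suc n′) ⟩
      (sweepFrom 0 ((p , (t ∸ e) + n′) , f) pre
         >>= prefixRun (IH.out₂ ++ (handedBack ∷ [])) (IH.swaps₂ + n′) (IH.time₂ + suc n′))
        ∎
  ; settled-size = refilled-size p t (n + f) e≤t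
  ; settled-fits = p≤f
  ; out₂-sizes   = trans (map-++ (size ∘ proj₁) IH.out₂ (handedBack ∷ []))
                     (trans (cong₂ _++_ IH.out₂-sizes (cong (_∷ []) handedBack-size))
                            (sym (unfold-reverse f′ (map proj₂ ys))))
  ; swaps-total  = begin
      (e + IH.swaps₁) + (IH.swaps₂ + n′)
        ≡⟨ regroup e IH.swaps₁ IH.swaps₂ n′ ⟩
      (n′ + e) + (IH.swaps₁ + IH.swaps₂)
        ≡⟨ cong₂ _+_ (sym (∣deficit∣ (p , t) (n + f))) IH.swaps-total ⟩
      ∣ δ ∣ + (∣ δ′ ∣ + sumAbsPrefixSums δ′ (map deficit ys))
        ≡⟨ cong (λ z → ∣ δ ∣ + (∣ z ∣ + sumAbsPrefixSums z (map deficit ys)))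
                (deficit-carry (p , t) (n + f) p′ t′ f′) ⟨
      ∣ δ ∣ + (∣ δ ℤ.+ deficit ((p′ , t′) , f′) ∣
                + sumAbsPrefixSums (δ ℤ.+ deficit ((p′ , t′) , f′)) (map deficit ys))
        ∎
  ; time₁-exact  = trans (cong (λ z → suc (e + z)) IH.time₁-exact) (time₁-regroup e (length ys) IH.swaps₁)
  ; time₂-exact  = trans (cong (_+ suc n′) IH.time₂-exact) (time₂-regroup (length ys) IH.swaps₂ n′)
  }
  where
  module IH = BothSweeps R
  e n′ : ℕ
  e  = (p + t) ∸ (n + f)
  n′ = (n + f) ∸ (p + t)
  δ δ′ : ℤ
  δ  = deficit ((p , t) , n + f)
  δ′ = deficit ((p′ , t′ + e) , n′ + f′)
  moved handedBack : Bucket × ℕ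
  moved      = ((p , t ∸ e) , f)
  handedBack = ((proj₁ IH.settled , proj₂ IH.settled ∸ n′) , f′)
  e≤t : e ≤ t
  e≤t = ≤-trans (∸-monoʳ-≤ (p + t) (≤-trans p≤f (m≤n+m f n))) (≤-reflexive (m+n∸m≡n p t))
  handedBack-size : size (proj₁ handedBack) ≡ f′
  handedBack-size = begin
    proj₁ IH.settled + (proj₂ IH.settled ∸ n′)  ≡⟨ +-∸-assoc (proj₁ IH.settled) n′≤staged ⟨
    size IH.settled ∸ n′                         ≡⟨ cong (_∸ n′) IH.settled-size ⟩
    n′ + f′ ∸ n′                                 ≡⟨ m+n∸m≡n n′ f′ ⟩
    f′                                           ∎
    where
    n′≤staged = m+u≡n+o∧m≤o⇒n≤u _ _ n′ f′ IH.settled-size IH.settled-fits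
  regroup : ∀ a b c d → (a + b) + (c + d) ≡ (d + a) + (b + c)
  regroup = solve-∀
  time₁-regroup : ∀ a l b → suc (a + (suc l + b)) ≡ suc (suc l) + (a + b)
  time₁-regroup = solve-∀
  time₂-regroup : ∀ l b a → (l + b) + suc a ≡ suc l + (b + a)
  time₂-regroup = solve-∀

bothSweeps : ∀ xs n p t f → p ≤ f → All Fits xs →
  (p + t) + totalSize xs ≡ (n + f) + totalFinal xs → BothSweeps n (p , t) f xs
bothSweeps [] n p t f p≤f [] balanced =
  bothSweeps-[] p≤f (trans (sym (+-identityʳ _)) (trans balanced (+-identityʳ _)))
bothSweeps (((p′ , t′) , f′) ∷ ys) n p t f p≤f (p′≤f′ ∷ fits) balanced =
  bothSweeps-∷ p≤f (bothSweeps ys n′ p′ (t′ + e) f′ p′≤f′ fits (begin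
    (p′ + (t′ + e)) + totalSize ys  ≡⟨ regroup p′ t′ e (totalSize ys) ⟩
    ((p′ + t′) + totalSize ys) + e  ≡⟨ m+x≡n+y⇒x+[m∸n]≡y+[n∸m] (p + t) (n + f) _ _ balanced ⟩
    (f′ + totalFinal ys) + n′       ≡⟨ regroup′ f′ (totalFinal ys) n′ ⟩
    (n′ + f′) + totalFinal ys       ∎))
  where
  e n′ : ℕ
  e  = (p + t) ∸ (n + f)
  n′ = (n + f) ∸ (p + t)
  regroup : ∀ a b c d → (a + (b + c)) + d ≡ ((a + b) + d) + c
  regroup = solve-∀
  regroup′ : ∀ a b c → (a + b) + c ≡ (c + a) + b
  regroup′ = solve-∀

finalSizes : ∀ {n b f xs} (R : BothSweeps n b f xs) → let open BothSweeps R in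
  map (size ∘ proj₁) (reverse (out₂ ++ (settled , f) ∷ [])) ≡ (n + f) ∷ map proj₂ xs
finalSizes {n} {f = f} {xs} R = begin
  map (size ∘ proj₁) (reverse (out₂ ++ (settled , f) ∷ []))
    ≡⟨ reverse-map (size ∘ proj₁) (out₂ ++ (settled , f) ∷ []) ⟩
  reverse (map (size ∘ proj₁) (out₂ ++ (settled , f) ∷ []))
    ≡⟨ cong reverse (map-++ (size ∘ proj₁) out₂ ((settled , f) ∷ [])) ⟩
  reverse (map (size ∘ proj₁) out₂ ++ size settled ∷ [])
    ≡⟨ cong reverse (cong₂ _++_ out₂-sizes (cong (_∷ []) settled-size)) ⟩
  reverse (reverse (map proj₂ xs) ++ (n + f) ∷ [])
    ≡⟨ reverse-++ (reverse (map proj₂ xs)) ((n + f) ∷ []) ⟩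
  (n + f) ∷ reverse (reverse (map proj₂ xs))
    ≡⟨ cong ((n + f) ∷_) (reverse-involutive (map proj₂ xs)) ⟩
  (n + f) ∷ map proj₂ xs
    ∎
  where open BothSweeps R

totalTime : ∀ {n b f xs} (R : BothSweeps n b f xs) → let open BothSweeps R in
  time₁ + (time₂ + 1) ≤ 2 * (suc (length xs) + (swaps₁ + swaps₂))
totalTime {xs = xs} R =
  ≤-trans (≤-reflexive exact)
    (≤-trans (+-monoʳ-≤ (2 * suc (length xs)) (m≤n*m (swaps₁ + swaps₂) 2))
             (≤-reflexive (sym (*-distribˡ-+ 2 (suc (length xs)) (swaps₁ + swaps₂)))))
  where
  open BothSweeps R
  regroup : ∀ l a b → (suc l + a) + ((l + b) + 1) ≡ 2 * suc l + (a + b)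
  regroup = solve-∀
  exact : time₁ + (time₂ + 1) ≡ 2 * suc (length xs) + (swaps₁ + swaps₂)
  exact = trans (cong₂ (λ a b → a + (b + 1)) time₁-exact time₂-exact) (regroup (length xs) swaps₁ swaps₂)

twoSweep-runs : ∀ {k s p f r₁ sw₁ t₁ r₂ sw₂ t₂} →
  sweep (initial k s p f) ≡ just (r₁ , sw₁ , t₁) →
  sweep (reverse r₁) ≡ just (r₂ , sw₂ , t₂) →
  twoSweep k s p f ≡ just (reverse r₂ , sw₁ + sw₂ , t₁ + t₂)
twoSweep-runs h₁ h₂ rewrite h₁ | h₂ = refl

module _ (k s : ℕ) (p f : Fin k → ℕ) where

  initial-finals : map proj₂ (initial k s p f) ≡ List.tabulate f
  initial-finals = map-tabulate _ proj₂

  initial-fits : (∀ i → p i ≤ f i) → All Fits (initial k s p f)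
  initial-fits = tabulate⁺

  initial-deficits : (∀ i → p i ≤ s) → map deficit (initial k s p f) ≡ List.tabulate (d s f)
  initial-deficits p≤s = trans (map-tabulate _ deficit)
    (tabulate-cong (λ i → cong (λ z → + f i ℤ.- + z) (m+[n∸m]≡n (p≤s i))))

initial-totalSize : ∀ k s (p f : Fin k → ℕ) → (∀ i → p i ≤ s) → totalSize (initial k s p f) ≡ k * s
initial-totalSize zero    s p f p≤s = refl
initial-totalSize (suc k) s p f p≤s =
  cong₂ _+_ (m+[n∸m]≡n (p≤s Fin.zero))
            (initial-totalSize k s (p ∘ Fin.suc) (f ∘ Fin.suc) (p≤s ∘ Fin.suc))

initial-balanced : ∀ k s (p f : Fin k → ℕ) → (∀ i → p i ≤ s) → sumℕ (List.tabulate f) ≡ k * s →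
  totalSize (initial k s p f) ≡ totalFinal (initial k s p f)
initial-balanced k s p f p≤s balanced =
  trans (initial-totalSize k s p f p≤s) (trans (sym balanced) (sym (cong sumℕ (initial-finals k s p f))))

sumAbsPrefixSums-tabulate : ∀ {k} (h : Fin k → ℤ) acc →
  sumℕ (List.tabulate (λ (i : Fin k) → ∣ acc ℤ.+ sumℤ (take (suc (toℕ i)) (List.tabulate h)) ∣)) ≡
  sumAbsPrefixSums acc (List.tabulate h)
sumAbsPrefixSums-tabulate {zero}  h acc = refl
sumAbsPrefixSums-tabulate {suc k} h acc =
  cong₂ _+_ (cong (λ z → ∣ acc ℤ.+ z ∣) (ℤₚ.+-identityʳ (h Fin.zero)))
    (trans (cong sumℕ (tabulate-cong {n = k} (λ i → cong ∣_∣ (sym (ℤₚ.+-assoc acc (h Fin.zero) _)))))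
           (sumAbsPrefixSums-tabulate (h ∘ Fin.suc) (acc ℤ.+ h Fin.zero)))

M≡sumAbsPrefixSums : ∀ s {k} (f : Fin k → ℕ) → M s f ≡ sumAbsPrefixSums (+ 0) (List.tabulate (d s f))
M≡sumAbsPrefixSums s f =
  trans (cong sumℕ (tabulate-cong (λ i → cong ∣_∣ (sym (ℤₚ.+-identityˡ (D s f i))))))
        (sumAbsPrefixSums-tabulate (d s f) (+ 0))

bothSweeps-initial : ∀ k s (p f : Fin (suc k) → ℕ) → (∀ i → p i ≤ s) → (∀ i → p i ≤ f i) →
  sumℕ (List.tabulate f) ≡ suc k * s →
  BothSweeps 0 (p Fin.zero , s ∸ p Fin.zero) (f Fin.zero) (initial k s (p ∘ Fin.suc) (f ∘ Fin.suc))
bothSweeps-initial k s p f p≤s p≤f balanced =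
  bothSweeps _ 0 (p Fin.zero) (s ∸ p Fin.zero) (f Fin.zero) (p≤f Fin.zero)
    (initial-fits k s (p ∘ Fin.suc) (f ∘ Fin.suc) (p≤f ∘ Fin.suc))
    (initial-balanced (suc k) s p f p≤s balanced)

initial-cost : ∀ k s (p f : Fin (suc k) → ℕ) → (∀ i → p i ≤ s) →
  let δ = deficit ((p Fin.zero , s ∸ p Fin.zero) , f Fin.zero) in
  ∣ δ ∣ + sumAbsPrefixSums δ (map deficit (initial k s (p ∘ Fin.suc) (f ∘ Fin.suc))) ≡ M s f
initial-cost k s p f p≤s = begin
  ∣ δ ∣ + sumAbsPrefixSums δ (map deficit (initial k s (p ∘ Fin.suc) (f ∘ Fin.suc)))
    ≡⟨ sumAbsPrefixSums-0∷ δ (map deficit (initial k s (p ∘ Fin.suc) (f ∘ Fin.suc))) ⟨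
  sumAbsPrefixSums (+ 0) (map deficit (initial (suc k) s p f))
    ≡⟨ cong (sumAbsPrefixSums (+ 0)) (initial-deficits (suc k) s p f p≤s) ⟩
  sumAbsPrefixSums (+ 0) (List.tabulate (d s f))
    ≡⟨ M≡sumAbsPrefixSums s f ⟨
  M s f
    ∎
  where
  δ : ℤ
  δ = deficit ((p Fin.zero , s ∸ p Fin.zero) , f Fin.zero)

lemma5 : ∃ λ (c : ℕ) →
    (k s : ℕ) (p f : Fin k → ℕ) →
    (∀ i → p i ≤ s) →
    (∀ i → p i ≤ f i) →
    sumℕ (List.tabulate f) ≡ k * s →
    Σ (List (Bucket × ℕ)) λ r → Σ ℕ λ swaps → Σ ℕ λ time →
      twoSweep k s p f ≡ just (r , swaps , time) ×
      map (size ∘ proj₁) r ≡ List.tabulate f ×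
      swaps ≡ M s f ×
      time ≤ c * (k + M s f)
lemma5 = 2 , λ where
  zero    _ _ _ _ _ _ → [] , 0 , 0 , refl , refl , refl , z≤n
  (suc k) s p f p≤s p≤f balanced →
    let R = bothSweeps-initial k s p f p≤s p≤f balanced
        open BothSweeps R
        swaps≡M = trans swaps-total (initial-cost k s p f p≤s)
    in reverse (out₂ ++ (settled , f Fin.zero) ∷ []) , swaps₁ + (swaps₂ + 0) , time₁ + (time₂ + 1) ,
       twoSweep-runs {suc k} {s} {p} {f} sweep₁ (sweep₂ []) ,
       trans (finalSizes R) (cong (f Fin.zero ∷_) (initial-finals k s (p ∘ Fin.suc) (f ∘ Fin.suc))) ,
       trans (cong (λ sw → swaps₁ + sw) (+-identityʳ swaps₂)) swaps≡M ,
       subst₂ (λ l m → time₁ + (time₂ + 1) ≤ 2 * (suc l + m)) (length-tabulate {n = k} _) swaps≡M (totalTime R)
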